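{- Let $\mathcal A$ be a $\mu\oplus$-context with $n$ holes at positions $\pi_1,\dots,\pi_n$ (in left-to-right order) and let $A_1,\dots,A_n$ be types such that $\mathcal A[A_1,\dots,A_n]\in\mathcal T$. Then $\mathsf T(\mathcal A[\vec A])=\mathcal A^{\setminus\mu}[\mathsf T(\mathcal A[\vec A]\!\downarrow_{\pi_1}),\dots,\mathsf T(\mathcal A[\vec A]\!\downarrow_{\pi_n})]$.
   Context: $\mu$-types: datatypes $D ::= \alpha\mid c\mid D\mathbin{@}A\mid D\oplus D\mid\mu\alpha.D$, types $A ::= X\mid D\mid A\supset A\mid A\oplus A\mid\mu X.A$ (datatype variables $\alpha$, type variables $X$, constants $c$; $a$ ranges over variables and constants; $V$ over variables), contractive ($V$ in $\mu V.A$ occurs only under $\supset$ or $@$); $\mathcal T$ is the set of such types. $\mathsf T(A)$ is the full unfolding of $A$ as a possibly infinite binary tree: $\mathsf T(a)(\epsilon)=a$; $\mathsf T(A_1\star A_2)(\epsilon)=\star$, $\mathsf T(A_1\star A_2)(i\pi)=\mathsf T(A_i)(\pi)$ for $\star\in\{@,\supset,\oplus\}$; $\mathsf T(\mu V.A)=\mathsf T(A\{\mu V.A/V\})$. Multi-hole $\mu\oplus$-contexts: $\mathcal A ::= \Box\mid\mu V.\mathcal A\mid\mathcal A\oplus\mathcal A$; $\mathcal A[\vec A]$ fills the holes left to right (variables bound by $\mu$ in $\mathcal A$ may occur in the fillers). Hole positions: $\Box$ has hole at $\epsilon$; in $\mu V.\mathcal A$ the child is at position $1$; in $\mathcal A_1\oplus\mathcal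 A_2$ children at $1,2$. Projection of a hole position: $\Box[A]\!\downarrow_\epsilon=A$; $(\mu V.\mathcal A[\vec A])\!\downarrow_{1\pi}=(\mathcal A[\vec A]\{\mu V.\mathcal A[\vec A]/V\})\!\downarrow_\pi$ (the substituted type viewed as the context $\mathcal A$ with substituted fillers); $(\mathcal A_1[\vec A_1]\oplus\mathcal A_2[\vec A_2])\!\downarrow_{i\pi}=\mathcal A_i[\vec A_i]\!\downarrow_\pi$. Erasure: $\Box^{\setminus\mu}=\Box$, $(\mu V.\mathcal A)^{\setminus\mu}=\mathcal A^{\setminus\mu}$, $(\mathcal A_1\oplus\mathcal A_2)^{\setminus\mu}=\mathcal A_1^{\setminus\mu}\oplus\mathcal A_2^{\setminus\mu}$; filling an erased context with trees yields a tree. -}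

module Defs where

open import Data.Nat using (ℕ; zero; suc)
open import Data.Fin using (Fin; zero; suc)
open import Data.Vec using (Vec; _∷_; lookup)
open import Data.List using (List; []; _∷_)
open import Data.Product using (_×_)
open import Data.Unit using (⊤)
open import Relation.Binary.PropositionalEquality using (_≡_; _≢_)

-- Raw μ-type syntax (de Bruijn indices; constants named by ℕ)

infixl 6 _⊕_
infixr 5 _⊃_
infixl 7 _＠_

data Ty (n : ℕ) : Set where
  var  : Fin n → Ty n
  con  : ℕ → Ty n
  _＠_  : Ty n → Ty n → Ty n
  _⊃_  : Ty n → Ty n → Ty n
  _⊕_  : Ty n → Ty n → Ty n
  μ    : Ty (suc n) → Ty n

Ren : ℕ → ℕ → Set
Ren m n = Fin m → Fin n

liftR : ∀ {m n} → Ren m n → Ren (suc m) (suc n)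
liftR ρ zero    = zero
liftR ρ (suc i) = suc (ρ i)

rename : ∀ {m n} → Ren m n → Ty m → Ty n
rename ρ (var i)   = var (ρ i)
rename ρ (con c)   = con c
rename ρ (A ＠ B)   = rename ρ A ＠ rename ρ B
rename ρ (A ⊃ B)   = rename ρ A ⊃ rename ρ B
rename ρ (A ⊕ B)   = rename ρ A ⊕ rename ρ B
rename ρ (μ A)     = μ (rename (liftR ρ) A)

Sub : ℕ → ℕ → Set
Sub m n = Fin m → Ty n

liftS : ∀ {m n} → Sub m n → Sub (suc m) (suc n)
liftS σ zero    = var zero
liftS σ (suc i) = rename suc (σ i)

subst : ∀ {m n} → Sub m n → Ty m → Ty n
subst σ (var i)   = σ i
subst σ (con c)   = con c
subst σ (A ＠ B)   = subst σ A ＠ subst σ B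
subst σ (A ⊃ B)   = subst σ A ⊃ subst σ B
subst σ (A ⊕ B)   = subst σ A ⊕ subst σ B
subst σ (μ A)     = μ (subst (liftS σ) A)

-- single substitution  A{B/V}  where V is the outermost bound variable (index 0)
sub0 : ∀ {n} → Ty n → Sub (suc n) n
sub0 B zero    = B
sub0 B (suc i) = var i

_[_/0] : ∀ {n} → Ty (suc n) → Ty n → Ty n
A [ B /0] = subst (sub0 B) A

-- Well-formedness: datatypes D and types A, with sorted variables
-- (datatype variables α vs type variables X)

data Sort : Set where
  dt ty : Sort

mutual
  data IsD {n} (Γ : Vec Sort n) : Ty n → Set where
    d-var : ∀ {i} → lookup Γ i ≡ dt → IsD Γ (var i)
    d-con : ∀ {c} → IsD Γ (con c)
    d-＠   : ∀ {D A} → IsD Γ D → IsA Γ A → IsD Γ (D ＠ A)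
    d-⊕   : ∀ {D E} → IsD Γ D → IsD Γ E → IsD Γ (D ⊕ E)
    d-μ   : ∀ {D} → IsD (dt ∷ Γ) D → IsD Γ (μ D)

  data IsA {n} (Γ : Vec Sort n) : Ty n → Set where
    a-var : ∀ {i} → lookup Γ i ≡ ty → IsA Γ (var i)
    a-D   : ∀ {D} → IsD Γ D → IsA Γ D
    a-⊃   : ∀ {A B} → IsA Γ A → IsA Γ B → IsA Γ (A ⊃ B)
    a-⊕   : ∀ {A B} → IsA Γ A → IsA Γ B → IsA Γ (A ⊕ B)
    a-μ   : ∀ {A} → IsA (ty ∷ Γ) A → IsA Γ (μ A)

-- Guarded x A : every occurrence of variable x in A lies under ⊃ or ＠
data Guarded {n} (x : Fin n) : Ty n → Set where
  g-var : ∀ {i} → i ≢ x → Guarded x (var i)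
  g-con : ∀ {c} → Guarded x (con c)
  g-＠   : ∀ {A B} → Guarded x (A ＠ B)
  g-⊃   : ∀ {A B} → Guarded x (A ⊃ B)
  g-⊕   : ∀ {A B} → Guarded x A → Guarded x B → Guarded x (A ⊕ B)
  g-μ   : ∀ {A} → Guarded (suc x) A → Guarded x (μ A)

data Contractive {n} : Ty n → Set where
  c-var : ∀ {i} → Contractive (var i)
  c-con : ∀ {c} → Contractive (con c)
  c-＠   : ∀ {A B} → Contractive A → Contractive B → Contractive (A ＠ B)
  c-⊃   : ∀ {A B} → Contractive A → Contractive B → Contractive (A ⊃ B)
  c-⊕   : ∀ {A B} → Contractive A → Contractive B → Contractive (A ⊕ B)
  c-μ   : ∀ {A} → Guarded zero A → Contractive A → Contractive (μ A)

-- membership in 𝒯 (types over free variables of sorts Γ)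
InT : ∀ {n} → Vec Sort n → Ty n → Set
InT Γ A = IsA Γ A × Contractive A

-- Infinite trees, represented by their graph: position ↦ label

data Dir : Set where
  d1 d2 : Dir

Pos : Set
Pos = List Dir

data Label (n : ℕ) : Set where
  lvar : Fin n → Label n
  lcon : ℕ → Label n
  l＠ l⊃ l⊕ : Label n

Tree : ℕ → Set₁
Tree n = Pos → Label n → Set

-- 𝖳(A): TreeOf A π l  iff  𝖳(A)(π) = l
data TreeOf {n} : Ty n → Tree n where
  t-var : ∀ {i} → TreeOf (var i) [] (lvar i)
  t-con : ∀ {c} → TreeOf (con c) [] (lcon c)
  t-＠   : ∀ {A B} → TreeOf (A ＠ B) [] l＠
  t-⊃   : ∀ {A B} → TreeOf (A ⊃ B) [] l⊃
  t-⊕   : ∀ {A B} → TreeOf (A ⊕ B) [] l⊕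
  t-＠1  : ∀ {A B π l} → TreeOf A π l → TreeOf (A ＠ B) (d1 ∷ π) l
  t-＠2  : ∀ {A B π l} → TreeOf B π l → TreeOf (A ＠ B) (d2 ∷ π) l
  t-⊃1  : ∀ {A B π l} → TreeOf A π l → TreeOf (A ⊃ B) (d1 ∷ π) l
  t-⊃2  : ∀ {A B π l} → TreeOf B π l → TreeOf (A ⊃ B) (d2 ∷ π) l
  t-⊕1  : ∀ {A B π l} → TreeOf A π l → TreeOf (A ⊕ B) (d1 ∷ π) l
  t-⊕2  : ∀ {A B π l} → TreeOf B π l → TreeOf (A ⊕ B) (d2 ∷ π) l
  t-μ   : ∀ {A π l} → TreeOf (A [ μ A /0]) π l → TreeOf (μ A) π l

data Ctx : Set where
  □    : Ctx
  μC   : Ctx → Ctx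
  _⊕C_ : Ctx → Ctx → Ctx

-- fillers for the holes of 𝒜 (in left-to-right order), each living in the
-- scope extended by the μ-binders of 𝒜 above that hole
data Fillers : ℕ → Ctx → Set where
  hole : ∀ {n} → Ty n → Fillers n □
  μF   : ∀ {n 𝒜} → Fillers (suc n) 𝒜 → Fillers n (μC 𝒜)
  _⊕F_ : ∀ {n 𝒜₁ 𝒜₂} → Fillers n 𝒜₁ → Fillers n 𝒜₂ → Fillers n (𝒜₁ ⊕C 𝒜₂)

plug : ∀ {n} (𝒜 : Ctx) → Fillers n 𝒜 → Ty n
plug □          (hole A)   = A
plug (μC 𝒜)     (μF fs)    = μ (plug 𝒜 fs)
plug (𝒜₁ ⊕C 𝒜₂) (fs ⊕F gs) = plug 𝒜₁ fs ⊕ plug 𝒜₂ gs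

substF : ∀ {m n 𝒜} → Sub m n → Fillers m 𝒜 → Fillers n 𝒜
substF σ (hole A)   = hole (subst σ A)
substF σ (μF fs)    = μF (substF (liftS σ) fs)
substF σ (fs ⊕F gs) = substF σ fs ⊕F substF σ gs

data HolePos : Ctx → Pos → Set where
  here : HolePos □ []
  inμ  : ∀ {𝒜 π} → HolePos 𝒜 π → HolePos (μC 𝒜) (d1 ∷ π)
  inl  : ∀ {𝒜₁ 𝒜₂ π} → HolePos 𝒜₁ π → HolePos (𝒜₁ ⊕C 𝒜₂) (d1 ∷ π)
  inr  : ∀ {𝒜₁ 𝒜₂ π} → HolePos 𝒜₂ π → HolePos (𝒜₁ ⊕C 𝒜₂) (d2 ∷ π)

proj : ∀ {n π} (𝒜 : Ctx) → Fillers n 𝒜 → HolePos 𝒜 π → Ty n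
proj □          (hole A)   here    = A
proj (μC 𝒜)     (μF fs)    (inμ p) = proj 𝒜 (substF (sub0 (plug (μC 𝒜) (μF fs))) fs) p
proj (𝒜₁ ⊕C 𝒜₂) (fs ⊕F gs) (inl p) = proj 𝒜₁ fs p
proj (𝒜₁ ⊕C 𝒜₂) (fs ⊕F gs) (inr p) = proj 𝒜₂ gs p

-- 𝒜^{∖μ}[t⃗]: fill the μ-erased context with trees, one tree per hole
-- (holes indexed by their positions in the original context 𝒜)
eraseFill : ∀ {n} (𝒜 : Ctx) → (∀ {π} → HolePos 𝒜 π → Tree n) → Tree n
eraseFill □          t ρ        l = t here ρ l
eraseFill (μC 𝒜)     t ρ        l = eraseFill 𝒜 (λ p → t (inμ p)) ρ l
eraseFill (𝒜₁ ⊕C 𝒜₂) t []       l = l ≡ l⊕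
eraseFill (𝒜₁ ⊕C 𝒜₂) t (d1 ∷ ρ) l = eraseFill 𝒜₁ (λ p → t (inl p)) ρ l
eraseFill (𝒜₁ ⊕C 𝒜₂) t (d2 ∷ ρ) l = eraseFill 𝒜₂ (λ p → t (inr p)) ρ l

module Submission where

-- The tree 𝖳(𝒜[A⃗]) is computed by peeling the context from the outside:
--   * at a hole, 𝒜[A⃗] is the filler itself, which is its own projection;
--   * at 𝒜₁ ⊕ 𝒜₂ the tree has root ⊕ and its two subtrees are those of the
--     two sub-contexts, exactly as in the erased context 𝒜₁^∖μ ⊕ 𝒜₂^∖μ;
--   * at μV.𝒜 the tree of μV.𝒜[A⃗] is the tree of its one-step unfolding,
--     which is again the context 𝒜, now filled with the substituted fillers
--     A⃗{μV.𝒜[A⃗]/V}; by definition the projections of μV.𝒜[A⃗] are the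
--     projections of this unfolded type, so the μ-binder simply disappears.

open import Defs
open import Data.Nat using (suc)
open import Data.Vec using (Vec)
open import Data.List using ([]; _∷_)
open import Function.Bundles using (_⇔_; mk⇔)
open import Function.Construct.Identity using (⇔-id)
open import Function.Construct.Composition using (_⇔-∘_)
open import Relation.Binary.PropositionalEquality using (_≡_; refl; cong; cong₂)

plug-subst : ∀ {m n} (𝒜 : Ctx) (σ : Sub m n) (As : Fillers m 𝒜)
           → subst σ (plug 𝒜 As) ≡ plug 𝒜 (substF σ As)
plug-subst □          σ (hole A)   = refl
plug-subst (μC 𝒜)     σ (μF As)    = cong μ (plug-subst 𝒜 (liftS σ) As)
plug-subst (𝒜₁ ⊕C 𝒜₂) σ (As ⊕F Bs) =
  cong₂ _⊕_ (plug-subst 𝒜₁ σ As) (plug-subst 𝒜₂ σ Bs)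

treeOf-cong : ∀ {n} {A B : Ty n} {ρ : Pos} {l : Label n}
            → A ≡ B → TreeOf A ρ l ⇔ TreeOf B ρ l
treeOf-cong refl = ⇔-id _

treeOf-μ : ∀ {n} {A : Ty (suc n)} {ρ : Pos} {l : Label n}
         → TreeOf (μ A) ρ l ⇔ TreeOf (A [ μ A /0]) ρ l
treeOf-μ = mk⇔ (λ { (t-μ t) → t }) t-μ

treeOf-⊕-root : ∀ {n} {A B : Ty n} {l : Label n}
              → TreeOf (A ⊕ B) [] l ⇔ (l ≡ l⊕)
treeOf-⊕-root = mk⇔ (λ { t-⊕ → refl }) (λ { refl → t-⊕ })

treeOf-⊕-left : ∀ {n} {A B : Ty n} {ρ : Pos} {l : Label n}
              → TreeOf (A ⊕ B) (d1 ∷ ρ) l ⇔ TreeOf A ρ l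
treeOf-⊕-left = mk⇔ (λ { (t-⊕1 t) → t }) t-⊕1

treeOf-⊕-right : ∀ {n} {A B : Ty n} {ρ : Pos} {l : Label n}
               → TreeOf (A ⊕ B) (d2 ∷ ρ) l ⇔ TreeOf B ρ l
treeOf-⊕-right = mk⇔ (λ { (t-⊕2 t) → t }) t-⊕2

unfold-μC : ∀ {n} (𝒜 : Ctx) (As : Fillers (suc n) 𝒜)
          → plug 𝒜 As [ plug (μC 𝒜) (μF As) /0]
            ≡ plug 𝒜 (substF (sub0 (plug (μC 𝒜) (μF As))) As)
unfold-μC 𝒜 As = plug-subst 𝒜 (sub0 (plug (μC 𝒜) (μF As))) As

treeOf-plug : ∀ {n} (𝒜 : Ctx) (As : Fillers n 𝒜) (ρ : Pos) (l : Label n)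
            → TreeOf (plug 𝒜 As) ρ l
              ⇔ eraseFill 𝒜 (λ p → TreeOf (proj 𝒜 As p)) ρ l
treeOf-plug □          (hole A)   ρ        l = ⇔-id _
treeOf-plug (μC 𝒜)     (μF As)    ρ        l =
  treeOf-plug 𝒜 (substF (sub0 (plug (μC 𝒜) (μF As))) As) ρ l
    ⇔-∘ (treeOf-cong (unfold-μC 𝒜 As) ⇔-∘ treeOf-μ)
treeOf-plug (𝒜₁ ⊕C 𝒜₂) (As ⊕F Bs) []       l = treeOf-⊕-root
treeOf-plug (𝒜₁ ⊕C 𝒜₂) (As ⊕F Bs) (d1 ∷ ρ) l = treeOf-plug 𝒜₁ As ρ l ⇔-∘ treeOf-⊕-left
treeOf-plug (𝒜₁ ⊕C 𝒜₂) (As ⊕F Bs) (d2 ∷ ρ) l = treeOf-plug 𝒜₂ Bs ρ l ⇔-∘ treeOf-⊕-right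

lemma2 : ∀ {n} (Γ : Vec Sort n) (𝒜 : Ctx) (As : Fillers n 𝒜)
    → InT Γ (plug 𝒜 As)
    → ∀ (ρ : Pos) (l : Label n)
    → TreeOf (plug 𝒜 As) ρ l ⇔ eraseFill 𝒜 (λ p → TreeOf (proj 𝒜 As p)) ρ l
lemma2 Γ 𝒜 As _ ρ l = treeOf-plug 𝒜 As ρ l
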